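{- Let $(a,b,c,r,s;x_1,y_1,\dots,x_N,y_N)$ be a set of solutions with $x_1=y_1=0$ and $x_i>0$, $y_i>0$ for all $i>1$. Then no two of $x_1,\dots,x_N$ are equal and no two of $y_1,\dots,y_N$ are equal, except when the set is in the same family as a subset (or an associate of a subset) of one of: $(2,2,6,1,5;0,0,2,1,4,1)$, $(3,3,3,1,2;0,0,1,1,2,1)$, $(2,6,2,1,1;0,0,2,1,3,1)$, $(2,2,4,1,3;0,0,3,2,4,2,1,1)$.
   Context: For integers $a>1$, $b>1$, $c>0$, $r>0$, $s>0$, a solution of $(-1)^u r a^x + (-1)^v s b^y = c$ is a quadruple $(x,y,u,v)$ with $x,y$ nonnegative integers and $u,v\in\{0,1\}$; it is referred to by the pair $(x,y)$. A set of solutions $(a,b,c,r,s;x_1,y_1,\dots,x_N,y_N)$ is the set of $N>2$ distinct pairs $(x_i,y_i)$, each a solution for the given $a,b,c,r,s$. Two sets of solutions $(a,b,c,r,s;x_1,y_1,\dots,x_N,y_N)$ and $(A,B,C,R,S;X_1,Y_1,\dots,X_N,Y_N)$ are in the same family if $a$ and $A$ are both powers of one integer, $b$ and $B$ are both powers of one integer, and there is a positive rational $k$ with $kc=C$ such that for every $i$ there is $j$ with $kra^{x_i}=RA^{X_j}$ and $ksb^{y_i}=SB^{Y_j}$. A subset of a set of solutions is any set of solutions (at least three pairs) with the same $a,b,c,r,s$ all of whose pairs are among the given ones. The associate of $(a,b,c,r,s;x_1,y_1,\dots,x_N,y_N)$ is $(b,a,c,s,r;y_1,x_1,\dots,y_N,x_N)$.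 -}

module Defs where

open import Data.Nat as ℕ using (ℕ; zero; suc; _<_; _≤_)
open import Data.Integer as ℤ using (ℤ; +_; -_)
open import Data.Rational as ℚ using (ℚ; Positive)
open import Data.Fin using (Fin)
open import Data.Product using (_×_; _,_; proj₁; proj₂; ∃; ∃-syntax; Σ)
open import Data.Sum using (_⊎_)
open import Data.List using (List; []; _∷_)
open import Data.List.Membership.Propositional using (_∈_)
open import Relation.Binary.PropositionalEquality using (_≡_)

record Params : Set where
  constructor ⟨_,_,_,_,_⟩
  field
    a b c r s : ℕ
open Params public

ValidParams : Params → Set
ValidParams p = 1 < a p × 1 < b p × 0 < c p × 0 < r p × 0 < s p

IsSolution : Params → ℕ × ℕ → Set
IsSolution p (x , y) =
  ∃[ u ] ∃[ v ] (u ≤ 1 × v ≤ 1 ×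
    ((- ℤ.1ℤ) ℤ.^ u ℤ.* (+ (r p)) ℤ.* (+ (a p)) ℤ.^ x
      ℤ.+ (- ℤ.1ℤ) ℤ.^ v ℤ.* (+ (s p)) ℤ.* (+ (b p)) ℤ.^ y ≡ + (c p)))

SetOfSolutions : Params → (N : ℕ) → (Fin N → ℕ × ℕ) → Set
SetOfSolutions p N P =
  ValidParams p × 2 < N
  × (∀ i j → P i ≡ P j → i ≡ j)
  × (∀ i → IsSolution p (P i))

PowersOfOne : ℕ → ℕ → Set
PowersOfOne a A = ∃[ g ] ∃[ m ] ∃[ n ] (+ a ≡ g ℤ.^ m × + A ≡ g ℤ.^ n)

ℕtoℚ : ℕ → ℚ
ℕtoℚ n = + n ℚ./ 1

SameFamily : (p : Params) (N : ℕ) (P : Fin N → ℕ × ℕ)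
             (q : Params) (Q : Fin N → ℕ × ℕ) → Set
SameFamily p N P q Q =
  PowersOfOne (a p) (a q) × PowersOfOne (b p) (b q) ×
  ∃[ k ] (Positive k × k ℚ.* ℕtoℚ (c p) ≡ ℕtoℚ (c q) ×
    (∀ i → ∃[ j ] (k ℚ.* ℕtoℚ (r p ℕ.* a p ℕ.^ proj₁ (P i)) ≡ ℕtoℚ (r q ℕ.* a q ℕ.^ proj₁ (Q j))
                 × k ℚ.* ℕtoℚ (s p ℕ.* b p ℕ.^ proj₂ (P i)) ≡ ℕtoℚ (s q ℕ.* b q ℕ.^ proj₂ (Q j)))))

SubsetOf : (q : Params) (L : List (ℕ × ℕ)) (M : ℕ) (Q : Fin M → ℕ × ℕ) → Set
SubsetOf q L M Q = SetOfSolutions q M Q × (∀ j → Q j ∈ L)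

assocParams : Params → Params
assocParams ⟨ a , b , c , r , s ⟩ = ⟨ b , a , c , s , r ⟩

swapPair : ℕ × ℕ → ℕ × ℕ
swapPair (x , y) = (y , x)

Exceptional : List (Params × List (ℕ × ℕ))
Exceptional =
    (⟨ 2 , 2 , 6 , 1 , 5 ⟩ , (0 , 0) ∷ (2 , 1) ∷ (4 , 1) ∷ [])
  ∷ (⟨ 3 , 3 , 3 , 1 , 2 ⟩ , (0 , 0) ∷ (1 , 1) ∷ (2 , 1) ∷ [])
  ∷ (⟨ 2 , 6 , 2 , 1 , 1 ⟩ , (0 , 0) ∷ (2 , 1) ∷ (3 , 1) ∷ [])
  ∷ (⟨ 2 , 2 , 4 , 1 , 3 ⟩ , (0 , 0) ∷ (3 , 2) ∷ (4 , 2) ∷ (1 , 1) ∷ [])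
  ∷ []

ExceptionalCase : (p : Params) (N : ℕ) (P : Fin N → ℕ × ℕ) → Set
ExceptionalCase p N P =
  ∃[ E ] (E ∈ Exceptional × ∃[ Q ] (SubsetOf (proj₁ E) (proj₂ E) N Q ×
    (SameFamily p N P (proj₁ E) Q
     ⊎ SameFamily p N P (assocParams (proj₁ E)) (λ i → swapPair (Q i)))))

-- A solution (x, y) satisfies one of r a^x + s b^y = c, r a^x = c + s b^y, s b^y = c + r a^x.
-- If two solutions (X, y₁), (X, y₂) with y₁ < y₂ share the first exponent, comparing them with
-- each other and with (0, 0) forces r a^X = c + s b^y₁ and s b^y₂ = c + r a^X, hence
-- s (b^y₂ − b^y₁) = 2c.  Writing A = a^X, B = b^y₁ and b^(y₂−y₁) = u + 1, this leaves one
-- Diophantine equation in u, B, A when r + s = c and another when r = c + s; both have finitely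
-- many solutions, and as b divides both B and u + 1 only five of them remain.  They fix (r, c) up
-- to the factor s and a, b up to the choice of a root of A and of u + 1.  For each of the seven
-- resulting equations r₀ a^x ± b^y = c₀ some M > c₀ divides a^K and b^L, so x < K or y < L and
-- a finite search lists all solutions: after an affine change of exponents they lie in the
-- associate of an exceptional set.  A repeated second exponent is the same situation for the
-- associate.

module Submission where

open import Defs
open import Data.Nat as ℕ
  using (ℕ; zero; suc; _+_; _*_; _∸_; _^_; _<_; _≤_; z≤n; s≤s; NonZero; >-nonZero; >-nonZero⁻¹; _≟_)
open import Data.Nat.Properties
open import Data.Nat.Divisibility
  using (_∣_; _∣?_; divides; m∣m*n; n∣m*n; ∣-trans; ∣⇒≤; ∣m∣n⇒∣m+n; ∣m+n∣m⇒∣n)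
open import Data.Nat.Coprimality using (Coprime; coprime?)
open import Data.Nat.Tactic.RingSolver using (solve)
open import Data.Integer as ℤ using (ℤ)
import Data.Integer.Properties as ℤ
open import Data.Integer.Tactic.RingSolver as ℤ-Ring using ()
open import Data.Rational as ℚ using (toℚᵘ)
import Data.Rational.Properties as ℚ
open import Data.Rational.Unnormalised as ℚᵘ using (mkℚᵘ; *≡*)
import Data.Rational.Unnormalised.Properties as ℚᵘ
open import Data.Fin as Fin using (Fin; zero; suc)
open import Data.Fin.Properties using (any?)
open import Data.List using (List; []; _∷_)
open import Data.List.Membership.Propositional using (_∈_)
import Data.List.Membership.DecPropositional as DecMembership
open import Data.List.Relation.Unary.Any using (here; there)
open import Data.List.Relation.Unary.All as All using (All; all?)
open import Data.Product using (_×_; _,_; proj₁; proj₂; ∃; ∃-syntax; swap)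
open import Data.Product.Properties using (≡-dec)
open import Data.Sum using (_⊎_; inj₁; inj₂)
open import Data.Empty using (⊥; ⊥-elim)
open import Function using (_∘_)
open import Relation.Nullary using (Dec; yes; no; ¬_)
open import Relation.Nullary.Decidable
  using (map′; decidable-stable; from-yes; ¬?; _⊎-dec_; _×-dec_; _→-dec_)
open import Relation.Binary using (Tri; tri<; tri≈; tri>)
open import Relation.Binary.PropositionalEquality

exceeds : ∀ {m n} → m ≡ n → ∀ k → m ≡ suc (n + k) → ⊥
exceeds refl k = m≢1+m+n _

halve : ∀ s {c} k → s * (k + k) ≡ c + c → c ≡ s * k
halve s {c} k s[k+k]≡2c = *-cancelˡ-≡ c (s * k) 2 (begin
  2 * c         ≡⟨ solve (c ∷ []) ⟩
  c + c         ≡⟨ s[k+k]≡2c ⟨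
  s * (k + k)   ≡⟨ solve (s ∷ k ∷ []) ⟩
  2 * (s * k)   ∎)
  where open ≡-Reasoning

2≤⇒suc : ∀ {m} → 2 ≤ m → ∃[ u ] (1 ≤ u × suc u ≡ m)
2≤⇒suc (s≤s (s≤s (z≤n {k}))) = suc k , s≤s z≤n , refl

n<m^n : ∀ {m} n → 2 ≤ m → n < m ^ n
n<m^n zero _ = s≤s z≤n
n<m^n {m} (suc n) 2≤m = begin-strict
  suc n       ≤⟨ n<m^n n 2≤m ⟩
  m ^ n       <⟨ m<m+n (m ^ n) (≤-<-trans z≤n (n<m^n n 2≤m)) ⟩
  m ^ n + m ^ n ≡⟨ cong (m ^ n +_) (sym (+-identityʳ (m ^ n))) ⟩
  2 * m ^ n   ≤⟨ *-monoˡ-≤ (m ^ n) 2≤m ⟩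
  m * m ^ n   ∎
  where open ≤-Reasoning

m^n∣m^o : ∀ m {n o} → n ≤ o → m ^ n ∣ m ^ o
m^n∣m^o m {n} {o} n≤o = divides (m ^ (o ∸ n)) (begin
  m ^ o             ≡⟨ cong (m ^_) (sym (m+[n∸m]≡n n≤o)) ⟩
  m ^ (n + (o ∸ n)) ≡⟨ ^-distribˡ-+-* m n (o ∸ n) ⟩
  m ^ n * m ^ (o ∸ n) ≡⟨ *-comm (m ^ n) _ ⟩
  m ^ (o ∸ n) * m ^ n ∎)
  where open ≡-Reasoning

m≤m^n : ∀ {m} n → 1 ≤ m → 1 ≤ n → m ≤ m ^ n
m≤m^n {m} (suc n) 1≤m _ = m≤m*n m (m ^ n) {{m^n≢0 m n {{>-nonZero 1≤m}}}}

m∣m^n : ∀ m {n} → 1 ≤ n → m ∣ m ^ n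
m∣m^n m {suc n} _ = m∣m*n (m ^ n)

common-factor⇒¬coprime : ∀ {d m n} → 2 ≤ d → d ∣ m → d ∣ n → ¬ Coprime m n
common-factor⇒¬coprime 2≤d d∣m d∣n coprime with coprime (d∣m , d∣n)
common-factor⇒¬coprime (s≤s ()) d∣m d∣n coprime | refl

^-affine : ∀ g e x t → g ^ (e * x + t) ≡ (g ^ e) ^ x * g ^ t
^-affine g e x t = trans (^-distribˡ-+-* g (e * x) t) (cong (_* g ^ t) (sym (^-*-assoc g e x)))

affine-injective : ∀ e t .{{_ : NonZero e}} {x x′} → e * x + t ≡ e * x′ + t → x ≡ x′
affine-injective e t eq = *-cancelˡ-≡ _ _ e (+-cancelʳ-≡ t _ _ eq)

-- (x − m)(y − k) = km, and y > k because m y > 0.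
hyperbola-bound : ∀ {x y k m} → 0 < m → 0 < y → x * y ≡ k * x + m * y → x ≤ m * suc k
hyperbola-bound {x} {y} {k} {m} 0<m 0<y eq with y ℕ.≤? k
... | yes y≤k = ⊥-elim (<-irrefl refl (begin-strict
  k * x + m * y ≡⟨ sym eq ⟩
  x * y         ≤⟨ *-monoʳ-≤ x y≤k ⟩
  x * k         ≡⟨ *-comm x k ⟩
  k * x         <⟨ m<m+n (k * x) (*-mono-< 0<m 0<y) ⟩
  k * x + m * y ∎))
  where open ≤-Reasoning
... | no y≰k with m≤n⇒∃[o]m+o≡n (≰⇒> y≰k) | x ℕ.≤? m * suc k
...   | _ | yes x≤m[1+k] = x≤m[1+k]
...   | j , 1+k+j≡y | no x≰m[1+k] = ⊥-elim (<-irrefl refl (begin-strict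
  m * (1 + k) + m * j <⟨ +-mono-<-≤ m[1+k]<x (*-monoˡ-≤ j (≤-trans (m≤m*n m (suc k)) (<⇒≤ m[1+k]<x))) ⟩
  x + x * j           ≡⟨ +-cancelˡ-≡ (k * x) _ _ shifted ⟩
  m * (1 + k) + m * j ∎))
  where
  open ≤-Reasoning
  m[1+k]<x : m * suc k < x
  m[1+k]<x = ≰⇒> x≰m[1+k]
  shifted : k * x + (x + x * j) ≡ k * x + (m * (1 + k) + m * j)
  shifted = begin-equality
    k * x + (x + x * j)         ≡⟨ solve (k ∷ x ∷ j ∷ []) ⟩
    x * (1 + k + j)             ≡⟨ cong (x *_) 1+k+j≡y ⟩
    x * y                       ≡⟨ eq ⟩
    k * x + m * y               ≡⟨ cong (λ t → k * x + m * t) (sym 1+k+j≡y) ⟩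
    k * x + m * (1 + k + j)     ≡⟨ solve (k ∷ x ∷ m ∷ j ∷ []) ⟩
    k * x + (m * (1 + k) + m * j) ∎

module _ {P : ℕ → ℕ → Set} (P? : ∀ x y → Dec (P x y)) where

  allBelow₂? : ∀ X Y → Dec (∀ {x} → x < X → ∀ {y} → y < Y → P x y)
  allBelow₂? X Y = allUpTo? (λ x → allUpTo? (P? x) Y) X

module _ {P : ℕ → ℕ → ℕ → Set} (P? : ∀ x y z → Dec (P x y z)) where

  allBelow₃? : ∀ X Y Z → Dec (∀ {x} → x < X → ∀ {y} → y < Y → ∀ {z} → z < Z → P x y z)
  allBelow₃? X Y Z = allUpTo? (λ x → allBelow₂? (P? x) Y Z) X

module Naturals = DecMembership _≟_

module Pairs = DecMembership (≡-dec _≟_ _≟_)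

module Triples = DecMembership (≡-dec _≟_ (≡-dec _≟_ _≟_))

module _ (N : ℕ) (roots : List ℕ) where

  RootsBelow : Set
  RootsBelow = ∀ {m} → m < suc N → ∀ {n} → n < N → 2 ≤ m → 1 ≤ n → m ^ n ≡ N → m ∈ roots

  rootsBelow? : Dec RootsBelow
  rootsBelow? =
    allBelow₂? (λ m n → 2 ℕ.≤? m →-dec 1 ℕ.≤? n →-dec m ^ n ≟ N →-dec m Naturals.∈? roots) (suc N) N

root∈ : ∀ {N roots} → RootsBelow N roots → ∀ {m n} → 2 ≤ m → 1 ≤ n → m ^ n ≡ N → m ∈ roots
root∈ below {m} {n} 2≤m 1≤n m^n≡N = below
  (s≤s (≤-trans (m≤m^n n (≤-trans (s≤s z≤n) 2≤m) 1≤n) (≤-reflexive m^n≡N)))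
  (<-≤-trans (n<m^n n 2≤m) (≤-reflexive m^n≡N)) 2≤m 1≤n m^n≡N

-- The three sign patterns of ±R ± S = C compatible with C > 0.
SignedSum : ℕ → ℕ → ℕ → Set
SignedSum R S C = R + S ≡ C ⊎ R ≡ C + S ⊎ S ≡ C + R

signedSum? : ∀ R S C → Dec (SignedSum R S C)
signedSum? R S C = (R + S ≟ C) ⊎-dec (R ≟ C + S) ⊎-dec (S ≟ C + R)

signedSum-comm : ∀ {R S C} → SignedSum R S C → SignedSum S R C
signedSum-comm {R} {S} (inj₁ e) = inj₁ (trans (+-comm S R) e)
signedSum-comm (inj₂ (inj₁ e)) = inj₂ (inj₂ e)
signedSum-comm (inj₂ (inj₂ e)) = inj₂ (inj₁ e)

signedSum⇒≤+ : ∀ {R S C} → SignedSum R S C → C ≤ R + S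
signedSum⇒≤+ (inj₁ e) = ≤-reflexive (sym e)
signedSum⇒≤+ {R} {S} {C} (inj₂ (inj₁ e)) = ≤-trans (subst (C ≤_) (sym e) (m≤m+n C S)) (m≤m+n R S)
signedSum⇒≤+ {R} {S} {C} (inj₂ (inj₂ e)) = ≤-trans (subst (C ≤_) (sym e) (m≤m+n C R)) (m≤n+m S R)

signedSum⇒≤ˡ : ∀ {R S C} → SignedSum R S C → R ≤ C + S
signedSum⇒≤ˡ {R} {S} (inj₁ e) = ≤-trans (subst (R ≤_) e (m≤m+n R S)) (m≤m+n _ S)
signedSum⇒≤ˡ (inj₂ (inj₁ e)) = ≤-reflexive e
signedSum⇒≤ˡ {R} {S} {C} (inj₂ (inj₂ e)) = ≤-trans (subst (R ≤_) (sym e) (m≤n+m R C)) (m≤n+m S C)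

signedSum⇒≤ʳ : ∀ {R S C} → SignedSum R S C → S ≤ C + R
signedSum⇒≤ʳ = signedSum⇒≤ˡ ∘ signedSum-comm

signedSum⇒∣ : ∀ {d R S C} → d ∣ R → d ∣ S → SignedSum R S C → d ∣ C
signedSum⇒∣ d∣R d∣S (inj₁ e) = subst (_ ∣_) e (∣m∣n⇒∣m+n d∣R d∣S)
signedSum⇒∣ {d} {R} {S} {C} d∣R d∣S (inj₂ (inj₁ e)) =
  ∣m+n∣m⇒∣n (subst (d ∣_) (trans e (+-comm C S)) d∣R) d∣S
signedSum⇒∣ d∣R d∣S (inj₂ (inj₂ e)) = signedSum⇒∣ d∣S d∣R (inj₂ (inj₁ e))

signedSum-cancelˡ-* : ∀ t {R S C} .{{_ : NonZero t}} →
  SignedSum (t * R) (t * S) (t * C) → SignedSum R S C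
signedSum-cancelˡ-* t {R} {S} {C} (inj₁ e) =
  inj₁ (*-cancelˡ-≡ _ _ t (trans (*-distribˡ-+ t R S) e))
signedSum-cancelˡ-* t {R} {S} {C} (inj₂ (inj₁ e)) =
  inj₂ (inj₁ (*-cancelˡ-≡ _ _ t (trans e (sym (*-distribˡ-+ t C S)))))
signedSum-cancelˡ-* t {R} {S} {C} (inj₂ (inj₂ e)) =
  inj₂ (inj₂ (*-cancelˡ-≡ _ _ t (trans e (sym (*-distribˡ-+ t C R)))))

+-^ : ∀ a x → (ℤ.+ a) ℤ.^ x ≡ ℤ.+ (a ^ x)
+-^ a zero = refl
+-^ a (suc x) = trans (cong ((ℤ.+ a) ℤ.*_) (+-^ a x)) (sym (ℤ.pos-* a (a ^ x)))

sign : ℕ → ℤ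
sign u = (ℤ.- ℤ.1ℤ) ℤ.^ u

signedTerm : ∀ u R a x → sign u ℤ.* ℤ.+ R ℤ.* (ℤ.+ a) ℤ.^ x ≡ sign u ℤ.* ℤ.+ (R * a ^ x)
signedTerm u R a x = begin
  sign u ℤ.* ℤ.+ R ℤ.* (ℤ.+ a) ℤ.^ x   ≡⟨ ℤ.*-assoc (sign u) (ℤ.+ R) _ ⟩
  sign u ℤ.* (ℤ.+ R ℤ.* (ℤ.+ a) ℤ.^ x) ≡⟨ cong (λ t → sign u ℤ.* (ℤ.+ R ℤ.* t)) (+-^ a x) ⟩
  sign u ℤ.* (ℤ.+ R ℤ.* ℤ.+ (a ^ x))   ≡⟨ cong (sign u ℤ.*_) (ℤ.pos-* R (a ^ x)) ⟨
  sign u ℤ.* ℤ.+ (R * a ^ x)           ∎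
  where open ≡-Reasoning

signs⇒signedSum : ∀ {R S C} u v → u ≤ 1 → v ≤ 1 → 0 < C →
  sign u ℤ.* ℤ.+ R ℤ.+ sign v ℤ.* ℤ.+ S ≡ ℤ.+ C → SignedSum R S C
signs⇒signedSum {R} {S} {C} 0 0 _ _ _ eq = inj₁ (ℤ.+-injective (begin
  ℤ.+ (R + S)                       ≡⟨ ℤ.pos-+ R S ⟩
  ℤ.+ R ℤ.+ ℤ.+ S                   ≡⟨ cong₂ ℤ._+_ (ℤ.*-identityˡ (ℤ.+ R)) (ℤ.*-identityˡ (ℤ.+ S)) ⟨
  ℤ.1ℤ ℤ.* ℤ.+ R ℤ.+ ℤ.1ℤ ℤ.* ℤ.+ S ≡⟨ eq ⟩
  ℤ.+ C                             ∎))
  where open ≡-Reasoning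
signs⇒signedSum {R} {S} {C} 0 1 _ _ _ eq = inj₂ (inj₁ (ℤ.+-injective (begin
  ℤ.+ R                              ≡⟨ i≡i-j+j (ℤ.+ R) (ℤ.+ S) ⟩
  (ℤ.+ R ℤ.- ℤ.+ S) ℤ.+ ℤ.+ S
    ≡⟨ cong (ℤ._+ ℤ.+ S) (cong₂ ℤ._+_ (ℤ.*-identityˡ (ℤ.+ R)) (ℤ.-1*i≡-i (ℤ.+ S))) ⟨
  (ℤ.1ℤ ℤ.* ℤ.+ R ℤ.+ ℤ.-1ℤ ℤ.* ℤ.+ S) ℤ.+ ℤ.+ S
                                     ≡⟨ cong (ℤ._+ ℤ.+ S) eq ⟩
  ℤ.+ C ℤ.+ ℤ.+ S                    ≡⟨ ℤ.pos-+ C S ⟨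
  ℤ.+ (C + S)                        ∎)))
  where
  open ≡-Reasoning
  i≡i-j+j : ∀ i j → i ≡ (i ℤ.- j) ℤ.+ j
  i≡i-j+j = ℤ-Ring.solve-∀
signs⇒signedSum {R} {S} 1 0 u≤1 v≤1 0<C eq =
  signedSum-comm (signs⇒signedSum 0 1 v≤1 u≤1 0<C
    (trans (ℤ.+-comm (sign 0 ℤ.* ℤ.+ S) (sign 1 ℤ.* ℤ.+ R)) eq))
signs⇒signedSum {R} {S} {suc C} 1 1 _ _ _ eq = ⊥-elim (-+≢+suc (R + S) (begin
  ℤ.- ℤ.+ (R + S)                     ≡⟨ cong ℤ.-_ (ℤ.pos-+ R S) ⟩
  ℤ.- (ℤ.+ R ℤ.+ ℤ.+ S)               ≡⟨ ℤ.neg-distrib-+ (ℤ.+ R) (ℤ.+ S) ⟩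
  ℤ.- ℤ.+ R ℤ.+ ℤ.- ℤ.+ S             ≡⟨ cong₂ ℤ._+_ (ℤ.-1*i≡-i (ℤ.+ R)) (ℤ.-1*i≡-i (ℤ.+ S)) ⟨
  ℤ.-1ℤ ℤ.* ℤ.+ R ℤ.+ ℤ.-1ℤ ℤ.* ℤ.+ S ≡⟨ eq ⟩
  ℤ.+ suc C                           ∎))
  where
  open ≡-Reasoning
  -+≢+suc : ∀ n → ℤ.- ℤ.+ n ≢ ℤ.+ suc C
  -+≢+suc zero ()
  -+≢+suc (suc n) ()
signs⇒signedSum (suc (suc _)) _ (s≤s ()) _ _ _
signs⇒signedSum _ (suc (suc _)) _ (s≤s ()) _ _

isSolution⇒signedSum : ∀ {p} x y → 0 < c p → IsSolution p (x , y) →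
  SignedSum (r p * a p ^ x) (s p * b p ^ y) (c p)
isSolution⇒signedSum {p} x y 0<c (u , v , u≤1 , v≤1 , eq) =
  signs⇒signedSum u v u≤1 v≤1 0<c
    (trans (sym (cong₂ ℤ._+_ (signedTerm u (r p) (a p) x) (signedTerm v (s p) (b p) y))) eq)

-- Two solutions with the same first exponent

signedSum-sharedˡ : ∀ {α β₁ β₂ c} → 0 < β₁ → β₁ < β₂ → SignedSum α β₁ c → SignedSum α β₂ c →
  (α + β₁ ≡ c ⊎ α ≡ c + β₁) × β₂ ≡ c + α
signedSum-sharedˡ {α} {β₁} {β₂} {c} 0<β₁ β₁<β₂ = shared
  where
  open ≤-Reasoning
  absurd : ∀ {n} → n < n → ∀ {A : Set} → A
  absurd n<n = ⊥-elim (<-irrefl refl n<n)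
  shared : SignedSum α β₁ c → SignedSum α β₂ c → (α + β₁ ≡ c ⊎ α ≡ c + β₁) × β₂ ≡ c + α
  shared (inj₁ e₁) (inj₂ (inj₂ e₂)) = inj₁ e₁ , e₂
  shared (inj₂ (inj₁ e₁)) (inj₂ (inj₂ e₂)) = inj₂ e₁ , e₂
  shared (inj₁ e₁) (inj₁ e₂) = absurd (begin-strict
    α + β₁ <⟨ +-monoʳ-< α β₁<β₂ ⟩ α + β₂ ≡⟨ e₂ ⟩ c ≡⟨ sym e₁ ⟩ α + β₁ ∎)
  shared (inj₁ e₁) (inj₂ (inj₁ e₂)) = absurd (begin-strict
    α ≤⟨ m≤m+n α β₁ ⟩ α + β₁ ≡⟨ e₁ ⟩ c <⟨ m<m+n c (≤-<-trans z≤n β₁<β₂) ⟩ c + β₂ ≡⟨ sym e₂ ⟩ α ∎)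
  shared (inj₂ (inj₁ e₁)) (inj₁ e₂) = absurd (begin-strict
    c <⟨ m<m+n c 0<β₁ ⟩ c + β₁ ≡⟨ sym e₁ ⟩ α ≤⟨ m≤m+n α β₂ ⟩ α + β₂ ≡⟨ e₂ ⟩ c ∎)
  shared (inj₂ (inj₁ e₁)) (inj₂ (inj₁ e₂)) = absurd (begin-strict
    c + β₁ <⟨ +-monoʳ-< c β₁<β₂ ⟩ c + β₂ ≡⟨ sym e₂ ⟩ α ≡⟨ e₁ ⟩ c + β₁ ∎)
  shared (inj₂ (inj₂ e₁)) (inj₁ e₂) = absurd (begin-strict
    β₂ ≤⟨ m≤n+m β₂ α ⟩ α + β₂ ≡⟨ e₂ ⟩ c ≤⟨ m≤m+n c α ⟩ c + α ≡⟨ sym e₁ ⟩ β₁ <⟨ β₁<β₂ ⟩ β₂ ∎)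
  shared (inj₂ (inj₂ e₁)) (inj₂ (inj₁ e₂)) = absurd (begin-strict
    β₂ ≤⟨ m≤n+m β₂ c ⟩ c + β₂ ≡⟨ sym e₂ ⟩ α ≤⟨ m≤n+m α c ⟩ c + α ≡⟨ sym e₁ ⟩ β₁ <⟨ β₁<β₂ ⟩ β₂ ∎)
  shared (inj₂ (inj₂ e₁)) (inj₂ (inj₂ e₂)) = absurd (begin-strict
    β₁ <⟨ β₁<β₂ ⟩ β₂ ≡⟨ e₂ ⟩ c + α ≡⟨ sym e₁ ⟩ β₁ ∎)

signedSum⇒+≢ : ∀ {r s c R S} → r < R → s < S → SignedSum r s c → R + S ≢ c
signedSum⇒+≢ {r} {s} {c} {R} {S} r<R s<S sol R+S≡c = <-irrefl refl (begin-strict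
  c ≤⟨ signedSum⇒≤+ sol ⟩ r + s <⟨ +-mono-< r<R s<S ⟩ R + S ≡⟨ R+S≡c ⟩ c ∎)
  where open ≤-Reasoning

Equation₊ Equation₋ : ℕ → ℕ → ℕ → Set
Equation₊ u B A = u * B * A ≡ u * B + 2 * B + 2 * A
Equation₋ u B A = u * B * A + 2 * A ≡ u * B + 2 * B

sharedFirstTerm⇒balance : ∀ {r s c A B u} → 0 < r → 0 < s → 2 ≤ A → 2 ≤ B → 1 ≤ u →
  SignedSum r s c → SignedSum (r * A) (s * B) c → SignedSum (r * A) (s * (suc u * B)) c →
  r * A ≡ c + s * B × s * (u * B) ≡ c + c
sharedFirstTerm⇒balance {r} {s} {c} {A} {B} {u} 0<r 0<s 2≤A 2≤B 1≤u sol₀ sol₁ sol₂ =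
  conclude (signedSum-sharedˡ 0<sB sB<s[1+u]B sol₁ sol₂)
  where
  instance
    r≢0 : NonZero r
    r≢0 = >-nonZero 0<r
    s≢0 : NonZero s
    s≢0 = >-nonZero 0<s
    B≢0 : NonZero B
    B≢0 = >-nonZero (≤-trans (s≤s z≤n) 2≤B)
    u≢0 : NonZero u
    u≢0 = >-nonZero 1≤u
  0<sB : 0 < s * B
  0<sB = >-nonZero⁻¹ (s * B) {{m*n≢0 s B}}
  s[1+u]B≡sB+s[uB] : s * (suc u * B) ≡ s * B + s * (u * B)
  s[1+u]B≡sB+s[uB] = solve (s ∷ u ∷ B ∷ [])
  sB<s[1+u]B : s * B < s * (suc u * B)
  sB<s[1+u]B = subst (s * B <_) (sym s[1+u]B≡sB+s[uB])
    (m<m+n (s * B) (>-nonZero⁻¹ (s * (u * B)) {{m*n≢0 s (u * B) {{s≢0}} {{m*n≢0 u B}}}}))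
  conclude : (r * A + s * B ≡ c ⊎ r * A ≡ c + s * B) × s * (suc u * B) ≡ c + r * A →
    r * A ≡ c + s * B × s * (u * B) ≡ c + c
  conclude (inj₁ rA+sB≡c , _) = ⊥-elim (signedSum⇒+≢ (m<m*n r A 2≤A) (m<m*n s B 2≤B) sol₀ rA+sB≡c)
  conclude (inj₂ rA≡c+sB , s[1+u]B≡c+rA) = rA≡c+sB , +-cancelˡ-≡ (s * B) _ _ (begin
    s * B + s * (u * B) ≡⟨ s[1+u]B≡sB+s[uB] ⟨
    s * (suc u * B)     ≡⟨ s[1+u]B≡c+rA ⟩
    c + r * A           ≡⟨ cong (c +_) rA≡c+sB ⟩
    c + (c + s * B)     ≡⟨ solve (c ∷ s ∷ B ∷ []) ⟩
    s * B + (c + c)     ∎)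
    where open ≡-Reasoning

balance⇒equation : ∀ {r s c A B u} → 0 < r → 0 < s → 2 ≤ u * B →
  r * A ≡ c + s * B → s * (u * B) ≡ c + c → SignedSum r s c →
  r + s ≡ c × Equation₊ u B A ⊎ r ≡ c + s × Equation₋ u B A
balance⇒equation {r} {s} {c} {A} {B} {u} 0<r 0<s 2≤uB rA≡c+sB s[uB]≡2c (inj₁ r+s≡c) =
  inj₁ (r+s≡c , *-cancelˡ-≡ _ _ s {{>-nonZero 0<s}} (begin
    s * (u * B * A)                         ≡⟨ solve (s ∷ u ∷ B ∷ A ∷ []) ⟩
    s * (u * B) * A                         ≡⟨ cong (_* A) s[uB]≡2c ⟩
    (c + c) * A                             ≡⟨ cong (λ t → (t + t) * A) r+s≡c ⟨
    ((r + s) + (r + s)) * A                 ≡⟨ solve (r ∷ s ∷ A ∷ []) ⟩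
    2 * (r * A) + 2 * (s * A)               ≡⟨ cong (λ t → 2 * t + 2 * (s * A)) rA≡c+sB ⟩
    2 * (c + s * B) + 2 * (s * A)           ≡⟨ solve (c ∷ s ∷ B ∷ A ∷ []) ⟩
    (c + c) + 2 * (s * B) + 2 * (s * A)     ≡⟨ cong (λ t → t + 2 * (s * B) + 2 * (s * A)) s[uB]≡2c ⟨
    s * (u * B) + 2 * (s * B) + 2 * (s * A) ≡⟨ solve (s ∷ u ∷ B ∷ A ∷ []) ⟩
    s * (u * B + 2 * B + 2 * A)             ∎))
  where open ≡-Reasoning
balance⇒equation {r} {s} {c} {A} {B} {u} 0<r 0<s 2≤uB rA≡c+sB s[uB]≡2c (inj₂ (inj₁ r≡c+s)) =
  inj₂ (r≡c+s , *-cancelˡ-≡ _ _ s {{>-nonZero 0<s}} (begin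
    s * (u * B * A + 2 * A)         ≡⟨ solve (s ∷ u ∷ B ∷ A ∷ []) ⟩
    s * (u * B) * A + 2 * (s * A)   ≡⟨ cong (λ t → t * A + 2 * (s * A)) s[uB]≡2c ⟩
    (c + c) * A + 2 * (s * A)       ≡⟨ solve (c ∷ s ∷ A ∷ []) ⟩
    2 * ((c + s) * A)               ≡⟨ cong (λ t → 2 * (t * A)) r≡c+s ⟨
    2 * (r * A)                     ≡⟨ cong (2 *_) rA≡c+sB ⟩
    2 * (c + s * B)                 ≡⟨ solve (c ∷ s ∷ B ∷ []) ⟩
    (c + c) + 2 * (s * B)           ≡⟨ cong (_+ 2 * (s * B)) s[uB]≡2c ⟨
    s * (u * B) + 2 * (s * B)       ≡⟨ solve (s ∷ u ∷ B ∷ []) ⟩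
    s * (u * B + 2 * B)             ∎))
  where open ≡-Reasoning
balance⇒equation {r} {s} {c} {A} {B} {u} 0<r 0<s 2≤uB rA≡c+sB s[uB]≡2c (inj₂ (inj₂ s≡c+r)) =
  ⊥-elim (<-irrefl refl (begin-strict
    c + c             <⟨ +-mono-< (m<n+m c 0<r) (m<n+m c 0<r) ⟩
    (r + c) + (r + c) ≡⟨ cong₂ _+_ (+-comm r c) (+-comm r c) ⟩
    (c + r) + (c + r) ≡⟨ cong (λ t → t + t) s≡c+r ⟨
    s + s             ≡⟨ solve (s ∷ []) ⟩
    s * 2             ≤⟨ *-monoʳ-≤ s 2≤uB ⟩
    s * (u * B)       ≡⟨ s[uB]≡2c ⟩
    c + c             ∎))
  where open ≤-Reasoning

-- The two Diophantine equations

admissible₊ : List (ℕ × ℕ × ℕ)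
admissible₊ = (1 , 4 , 6) ∷ (1 , 8 , 4) ∷ (2 , 3 , 3) ∷ (3 , 4 , 2) ∷ []

equation₊-u<5 : ∀ {u B A} → 2 ≤ B → 2 ≤ A → Equation₊ u B A → u < 5
equation₊-u<5 2≤B 2≤A eq = ≰⇒> (λ 5≤u → large 5≤u 2≤B 2≤A eq)
  where
  large : ∀ {u B A} → 5 ≤ u → 2 ≤ B → 2 ≤ A → ¬ Equation₊ u B A
  large (s≤s (s≤s (s≤s (s≤s (s≤s (z≤n {u})))))) (s≤s (s≤s (z≤n {B}))) (s≤s (s≤s (z≤n {A}))) eq =
    exceeds eq (1 + 8 * A + 5 * A * B + A * B * u + 2 * A * u + 3 * B + B * u + 2 * u)
      (solve (u ∷ B ∷ A ∷ []))

-- With x = uB and y = uA the equation reads xy = (u + 2)x + 2y.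
equation₊-bounds : ∀ {u B A} → 1 ≤ u → 2 ≤ B → 2 ≤ A → Equation₊ u B A → u < 5 × B < 15 × A < 19
equation₊-bounds {u} {B} {A} 1≤u 2≤B 2≤A eq = u<5 , B<15 , A<19
  where
  instance
    u≢0 : NonZero u
    u≢0 = >-nonZero 1≤u
  u<5 : u < 5
  u<5 = equation₊-u<5 2≤B 2≤A eq
  hyperbola : (u * B) * (u * A) ≡ (u + 2) * (u * B) + 2 * (u * A)
  hyperbola = begin
    (u * B) * (u * A)                ≡⟨ solve (u ∷ B ∷ A ∷ []) ⟩
    u * (u * B * A)                  ≡⟨ cong (u *_) eq ⟩
    u * (u * B + 2 * B + 2 * A)      ≡⟨ solve (u ∷ B ∷ A ∷ []) ⟩
    (u + 2) * (u * B) + 2 * (u * A)  ∎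
    where open ≡-Reasoning
  hyperbola′ : (u * A) * (u * B) ≡ 2 * (u * A) + (u + 2) * (u * B)
  hyperbola′ = trans (*-comm (u * A) (u * B))
    (trans hyperbola (+-comm ((u + 2) * (u * B)) (2 * (u * A))))
  0<uB : 0 < u * B
  0<uB = ≤-trans (≤-trans (s≤s z≤n) 2≤B) (m≤n*m B u)
  0<uA : 0 < u * A
  0<uA = ≤-trans (≤-trans (s≤s z≤n) 2≤A) (m≤n*m A u)
  B<15 : B < 15
  B<15 = s≤s (begin
    B                 ≤⟨ m≤n*m B u ⟩
    u * B             ≤⟨ hyperbola-bound {k = u + 2} {m = 2} (s≤s z≤n) 0<uA hyperbola ⟩
    2 * suc (u + 2)   ≤⟨ *-monoʳ-≤ 2 (s≤s (+-monoˡ-≤ 2 (≤-pred u<5))) ⟩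
    14                ∎)
    where open ≤-Reasoning
  A<19 : A < 19
  A<19 = s≤s (begin
    A                 ≤⟨ m≤n*m A u ⟩
    u * A             ≤⟨ hyperbola-bound (≤-trans (s≤s z≤n) (m≤n+m 2 u)) 0<uB hyperbola′ ⟩
    (u + 2) * 3       ≤⟨ *-monoˡ-≤ 3 (+-monoˡ-≤ 2 (≤-pred u<5)) ⟩
    18                ∎)
    where open ≤-Reasoning

equation₊-admissible : ∀ {u B A} → 1 ≤ u → 2 ≤ B → 2 ≤ A → Equation₊ u B A → ¬ Coprime B (suc u) →
  (u , B , A) ∈ admissible₊
equation₊-admissible 1≤u 2≤B 2≤A eq ¬coprime with equation₊-bounds 1≤u 2≤B 2≤A eq
... | u<5 , B<15 , A<19 = from-yes (allBelow₃? admissible? 5 15 19) u<5 B<15 A<19 1≤u 2≤B eq ¬coprime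
  where
  admissible? : ∀ u B A →
    Dec (1 ≤ u → 2 ≤ B → Equation₊ u B A → ¬ Coprime B (suc u) → (u , B , A) ∈ admissible₊)
  admissible? u B A = 1 ℕ.≤? u →-dec 2 ℕ.≤? B →-dec u * B * A ≟ u * B + 2 * B + 2 * A →-dec
    ¬? (coprime? B (suc u)) →-dec (u , B , A) Triples.∈? admissible₊

equation₋-solution : ∀ {u B A} → 1 ≤ u → 2 ≤ B → 2 ≤ A → Equation₋ u B A → u ≡ 1 × B ≡ 4 × A ≡ 2
equation₋-solution (s≤s (z≤n {u})) (s≤s (s≤s (z≤n {B}))) (s≤s (s≤s (z≤n {suc A}))) eq =
  ⊥-elim (exceeds eq (5 + 4 * A + A * B + u * (2 + B) * (2 + A)) (solve (u ∷ B ∷ A ∷ [])))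
equation₋-solution (s≤s (z≤n {suc u})) (s≤s (s≤s (z≤n {B}))) (s≤s (s≤s (z≤n {0}))) eq =
  ⊥-elim (exceeds eq (3 + 2 * u + u * B) (solve (u ∷ B ∷ [])))
equation₋-solution (s≤s (z≤n {0})) (s≤s (s≤s (z≤n {B}))) (s≤s (s≤s (z≤n {0}))) eq =
  refl , cong (2 +_) (+-cancelʳ-≡ 6 B 2 (sym (+-cancelˡ-≡ (2 * B) 8 (B + 6) (begin
    2 * B + 8                   ≡⟨ solve (B ∷ []) ⟩
    1 * (2 + B) * 2 + 2 * 2     ≡⟨ eq ⟩
    1 * (2 + B) + 2 * (2 + B)   ≡⟨ solve (B ∷ []) ⟩
    2 * B + (B + 6)             ∎)))) , refl
  where open ≡-Reasoning

-- Equations all of whose solutions can be listed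

module Enumeration (a₀ b₀ r₀ c₀ eᵃ tᵃ eᵇ tᵇ : ℕ) (pairs : List (ℕ × ℕ)) where

  Solution₀ : ℕ → ℕ → Set
  Solution₀ x y = SignedSum (r₀ * a₀ ^ x) (b₀ ^ y) c₀

  -- If x ≥ K and y ≥ L then M divides both terms, hence c₀ < M.
  solution-bounded : ∀ {M K L x y} → 2 ≤ a₀ → 2 ≤ b₀ → 0 < r₀ → 0 < c₀ → c₀ < M →
    M ∣ a₀ ^ K → M ∣ b₀ ^ L → Solution₀ x y →
    x < K × y < c₀ + r₀ * a₀ ^ K ⊎ y < L × x < c₀ + b₀ ^ L
  solution-bounded {M} {K} {L} {x} {y} 2≤a₀ 2≤b₀ 0<r₀ 0<c₀ c₀<M M∣a₀^K M∣b₀^L sol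
    with x ℕ.<? K | y ℕ.<? L
  ... | yes x<K | _ = inj₁ (x<K , (begin-strict
    y                 <⟨ n<m^n y 2≤b₀ ⟩
    b₀ ^ y            ≤⟨ signedSum⇒≤ʳ sol ⟩
    c₀ + r₀ * a₀ ^ x  ≤⟨ +-monoʳ-≤ c₀ (*-monoʳ-≤ r₀ (^-monoʳ-≤ a₀ {{a₀≢0}} (<⇒≤ x<K))) ⟩
    c₀ + r₀ * a₀ ^ K  ∎))
    where
    open ≤-Reasoning
    a₀≢0 : NonZero a₀
    a₀≢0 = >-nonZero (≤-trans (s≤s z≤n) 2≤a₀)
  ... | no _ | yes y<L = inj₂ (y<L , (begin-strict
    x                 <⟨ n<m^n x 2≤a₀ ⟩
    a₀ ^ x            ≤⟨ m≤n*m (a₀ ^ x) r₀ {{>-nonZero 0<r₀}} ⟩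
    r₀ * a₀ ^ x       ≤⟨ signedSum⇒≤ˡ sol ⟩
    c₀ + b₀ ^ y       ≤⟨ +-monoʳ-≤ c₀ (^-monoʳ-≤ b₀ {{b₀≢0}} (<⇒≤ y<L)) ⟩
    c₀ + b₀ ^ L       ∎))
    where
    open ≤-Reasoning
    b₀≢0 : NonZero b₀
    b₀≢0 = >-nonZero (≤-trans (s≤s z≤n) 2≤b₀)
  ... | no x≮K | no y≮L = ⊥-elim (<⇒≱ c₀<M (∣⇒≤ {{>-nonZero 0<c₀}} (signedSum⇒∣
    (∣-trans (∣-trans M∣a₀^K (m^n∣m^o a₀ (≮⇒≥ x≮K))) (n∣m*n r₀))
    (∣-trans M∣b₀^L (m^n∣m^o b₀ (≮⇒≥ y≮L))) sol)))

  Covered : ℕ → ℕ → Set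
  Covered x y = Solution₀ x y → (eᵇ * y + tᵇ , eᵃ * x + tᵃ) ∈ pairs

  covered? : ∀ x y → Dec (Covered x y)
  covered? x y = signedSum? (r₀ * a₀ ^ x) (b₀ ^ y) c₀ →-dec (eᵇ * y + tᵇ , eᵃ * x + tᵃ) Pairs.∈? pairs

  Enumerable : ℕ → ℕ → ℕ → Set
  Enumerable M K L = (2 ≤ a₀ × 2 ≤ b₀ × 0 < r₀ × 0 < c₀ × c₀ < M × M ∣ a₀ ^ K × M ∣ b₀ ^ L)
    × (∀ {x} → x < K → ∀ {y} → y < c₀ + r₀ * a₀ ^ K → Covered x y)
    × (∀ {y} → y < L → ∀ {x} → x < c₀ + b₀ ^ L → Covered x y)

  enumerable? : ∀ M K L → Dec (Enumerable M K L)
  enumerable? M K L =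
    (2 ℕ.≤? a₀ ×-dec 2 ℕ.≤? b₀ ×-dec 0 ℕ.<? r₀ ×-dec 0 ℕ.<? c₀ ×-dec c₀ ℕ.<? M
      ×-dec M ∣? a₀ ^ K ×-dec M ∣? b₀ ^ L)
    ×-dec allBelow₂? covered? K (c₀ + r₀ * a₀ ^ K)
    ×-dec allBelow₂? (λ y x → covered? x y) L (c₀ + b₀ ^ L)

  solutions-covered : ∀ {M K L} → Enumerable M K L → ∀ x y → Covered x y
  solutions-covered ((2≤a₀ , 2≤b₀ , 0<r₀ , 0<c₀ , c₀<M , M∣a₀^K , M∣b₀^L) , small-x , small-y) x y sol
    with solution-bounded 2≤a₀ 2≤b₀ 0<r₀ 0<c₀ c₀<M M∣a₀^K M∣b₀^L sol
  ... | inj₁ (x<K , y<) = small-x x<K y< sol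
  ... | inj₂ (y<L , x<) = small-y y<L x< sol

isSolution? : ∀ p z → Dec (IsSolution p z)
isSolution? p (x , y) =
  map′ to from (anyUpTo? (λ u → anyUpTo? (λ v → signedValue u v ℤ.≟ ℤ.+ (c p)) 2) 2)
  where
  signedValue : ℕ → ℕ → ℤ
  signedValue u v = sign u ℤ.* ℤ.+ r p ℤ.* (ℤ.+ a p) ℤ.^ x ℤ.+ sign v ℤ.* ℤ.+ s p ℤ.* (ℤ.+ b p) ℤ.^ y
  to : (∃ λ u → u < 2 × ∃ λ v → v < 2 × signedValue u v ≡ ℤ.+ (c p)) → IsSolution p (x , y)
  to (u , s≤s u≤1 , v , s≤s v≤1 , eq) = u , v , u≤1 , v≤1 , eq
  from : IsSolution p (x , y) → ∃ λ u → u < 2 × ∃ λ v → v < 2 × signedValue u v ≡ ℤ.+ (c p)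
  from (u , v , u≤1 , v≤1 , eq) = u , s≤s u≤1 , v , s≤s v≤1 , eq

validParams? : ∀ p → Dec (ValidParams p)
validParams? p = 1 ℕ.<? a p ×-dec 1 ℕ.<? b p ×-dec 0 ℕ.<? c p ×-dec 0 ℕ.<? r p ×-dec 0 ℕ.<? s p

exceptional-sound : All (λ E → ValidParams (proj₁ E) × All (IsSolution (proj₁ E)) (proj₂ E)) Exceptional
exceptional-sound =
  from-yes (all? (λ E → validParams? (proj₁ E) ×-dec all? (isSolution? (proj₁ E)) (proj₂ E)) Exceptional)

powersOfOne : ∀ {x y} e → x ≡ y ^ e → PowersOfOne x y
powersOfOne {x} {y} e x≡y^e =
  ℤ.+ y , e , 1 , trans (cong ℤ.+_ x≡y^e) (sym (+-^ y e)) , sym (ℤ.^-identityʳ (ℤ.+ y))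

rescale : ∀ {C R S T c₀ V W} t → C * R ≡ S * T * c₀ → W ≡ V * T → C * (t * R * V) ≡ S * W * (t * c₀)
rescale {C} {R} {S} {T} {c₀} {V} t CR≡STc₀ refl = begin
  C * (t * R * V)       ≡⟨ solve (C ∷ t ∷ R ∷ V ∷ []) ⟩
  t * (C * R) * V       ≡⟨ cong (λ z → t * z * V) CR≡STc₀ ⟩
  t * (S * T * c₀) * V  ≡⟨ solve (t ∷ S ∷ T ∷ c₀ ∷ V ∷ []) ⟩
  S * (V * T) * (t * c₀) ∎
  where open ≡-Reasoning

ℕtoℚ-rescale : ∀ q d N M .{{_ : NonZero d}} → q * N ≡ M * d → (ℤ.+ q ℚ./ d) ℚ.* ℕtoℚ N ≡ ℕtoℚ M
ℕtoℚ-rescale q d@(suc d-1) N M qN≡Md = ℚ.toℚᵘ-injective (let open ℚᵘ.≃-Reasoning in begin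
  toℚᵘ (ℤ.+ q ℚ./ d ℚ.* ℕtoℚ N)               ≈⟨ ℚ.toℚᵘ-homo-* (ℤ.+ q ℚ./ d) (ℕtoℚ N) ⟩
  toℚᵘ (ℤ.+ q ℚ./ d) ℚᵘ.* toℚᵘ (ℕtoℚ N)
    ≈⟨ ℚᵘ.*-cong (ℚ.toℚᵘ-fromℚᵘ (mkℚᵘ (ℤ.+ q) d-1)) (ℚ.toℚᵘ-fromℚᵘ (mkℚᵘ (ℤ.+ N) 0)) ⟩
  mkℚᵘ (ℤ.+ q) d-1 ℚᵘ.* mkℚᵘ (ℤ.+ N) 0        ≈⟨ *≡* cross ⟩
  mkℚᵘ (ℤ.+ M) 0                               ≈⟨ ℚ.toℚᵘ-fromℚᵘ (mkℚᵘ (ℤ.+ M) 0) ⟨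
  toℚᵘ (ℕtoℚ M)                                ∎)
  where
  cross : (ℤ.+ q ℤ.* ℤ.+ N) ℤ.* ℤ.+ 1 ≡ ℤ.+ M ℤ.* ℤ.+ suc (d-1 * 1)
  cross = let open ≡-Reasoning in begin
    (ℤ.+ q ℤ.* ℤ.+ N) ℤ.* ℤ.+ 1 ≡⟨ ℤ.*-identityʳ _ ⟩
    ℤ.+ q ℤ.* ℤ.+ N              ≡⟨ ℤ.pos-* q N ⟨
    ℤ.+ (q * N)                  ≡⟨ cong ℤ.+_ qN≡Md ⟩
    ℤ.+ (M * d)                  ≡⟨ ℤ.pos-* M d ⟩
    ℤ.+ M ℤ.* ℤ.+ d              ≡⟨ cong (λ t → ℤ.+ M ℤ.* ℤ.+ suc t) (*-identityʳ d-1) ⟨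
    ℤ.+ M ℤ.* ℤ.+ suc (d-1 * 1)  ∎

-- The solutions (x, y) of r₀ a₀^x ± b₀^y = c₀ map, through x ↦ eᵃ x + tᵃ and y ↦ eᵇ y + tᵇ,
-- into the associate of the exceptional set (q, pairs).
record Embedding (a₀ b₀ r₀ c₀ : ℕ) : Set where
  field
    q : Params
    pairs : List (ℕ × ℕ)
    listed : (q , pairs) ∈ Exceptional
    eᵃ tᵃ eᵇ tᵇ : ℕ
    eᵃ≢0 : NonZero eᵃ
    eᵇ≢0 : NonZero eᵇ
    a₀≡ : a₀ ≡ b q ^ eᵃ
    b₀≡ : b₀ ≡ a q ^ eᵇ
    scaleᵃ : c q * r₀ ≡ s q * b q ^ tᵃ * c₀
    scaleᵇ : c q * 1 ≡ r q * a q ^ tᵇ * c₀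
    covers : ∀ x y → SignedSum (r₀ * a₀ ^ x) (b₀ ^ y) c₀ → (eᵇ * y + tᵇ , eᵃ * x + tᵃ) ∈ pairs

  image : ℕ × ℕ → ℕ × ℕ
  image (x , y) = eᵇ * y + tᵇ , eᵃ * x + tᵃ

embedding-sameFamily : ∀ {a₀ b₀ r₀ c₀ t N} .{{_ : NonZero (t * c₀)}} (emb : Embedding a₀ b₀ r₀ c₀)
  (P : Fin N → ℕ × ℕ) →
  SameFamily ⟨ a₀ , b₀ , t * c₀ , t * r₀ , t ⟩ N P
    (assocParams (Embedding.q emb)) (swapPair ∘ Embedding.image emb ∘ P)
embedding-sameFamily {a₀} {b₀} {r₀} {c₀} {t} emb P =
  powersOfOne eᵃ a₀≡ , powersOfOne eᵇ b₀≡ , ℤ.+ c q ℚ./ (t * c₀) , ℚ.normalize-pos (c q) (t * c₀)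
  , ℕtoℚ-rescale (c q) (t * c₀) (t * c₀) (c q) refl
  , λ i → i
    , ℕtoℚ-rescale (c q) (t * c₀) _ (s q * b q ^ (eᵃ * proj₁ (P i) + tᵃ)) (rescaleᵃ (proj₁ (P i)))
    , ℕtoℚ-rescale (c q) (t * c₀) _ (r q * a q ^ (eᵇ * proj₂ (P i) + tᵇ)) (rescaleᵇ (proj₂ (P i)))
  where
  open Embedding emb
  instance
    c[q]≢0 : NonZero (c q)
    c[q]≢0 = >-nonZero (proj₁ (proj₂ (proj₂ (proj₁ (All.lookup exceptional-sound listed)))))
  rescaleᵃ : ∀ x → c q * (t * r₀ * a₀ ^ x) ≡ s q * b q ^ (eᵃ * x + tᵃ) * (t * c₀)
  rescaleᵃ x = rescale {C = c q} {R = r₀} {S = s q} {T = b q ^ tᵃ} {V = a₀ ^ x} t scaleᵃ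
    (trans (^-affine (b q) eᵃ x tᵃ) (cong (λ z → z ^ x * b q ^ tᵃ) (sym a₀≡)))
  rescaleᵇ : ∀ y → c q * (t * b₀ ^ y) ≡ r q * a q ^ (eᵇ * y + tᵇ) * (t * c₀)
  rescaleᵇ y = trans (cong (λ z → c q * (z * b₀ ^ y)) (sym (*-identityʳ t)))
    (rescale {C = c q} {R = 1} {S = r q} {T = a q ^ tᵇ} {V = b₀ ^ y} t scaleᵇ
      (trans (^-affine (a q) eᵇ y tᵇ) (cong (λ z → z ^ y * a q ^ tᵇ) (sym b₀≡))))

Reduced : Params → Set
Reduced p = ∃[ r₀ ] ∃[ c₀ ] (r p ≡ s p * r₀ × c p ≡ s p * c₀ × Embedding (a p) (b p) r₀ c₀)

reduced⇒exceptionalCase : ∀ {p n P} → SetOfSolutions p (suc n) P → Reduced p →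
  ExceptionalCase p (suc n) P
reduced⇒exceptionalCase {⟨ a₀ , b₀ , _ , _ , t ⟩} {n} {P}
  ((_ , _ , 0<c , _ , 0<t) , 2<N , P-injective , P-solutions) (r₀ , c₀ , refl , refl , emb) =
  (q , pairs) , listed , image ∘ P
  , ((valid , 2<N , Q-injective , λ i → All.lookup solutions (Q∈ i)) , Q∈)
  , inj₂ (embedding-sameFamily {t = t} {{>-nonZero 0<c}} emb P)
  where
  open Embedding emb
  valid : ValidParams q
  valid = proj₁ (All.lookup exceptional-sound listed)
  solutions : All (IsSolution q) pairs
  solutions = proj₂ (All.lookup exceptional-sound listed)
  Q∈ : ∀ i → image (P i) ∈ pairs
  Q∈ i = covers x y (signedSum-cancelˡ-* t {{>-nonZero 0<t}}
    (subst (λ R → SignedSum R (t * b₀ ^ y) (t * c₀)) (*-assoc t r₀ (a₀ ^ x))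
      (isSolution⇒signedSum x y 0<c (P-solutions i))))
    where
    x y : ℕ
    x = proj₁ (P i)
    y = proj₂ (P i)
  Q-injective : ∀ i j → image (P i) ≡ image (P j) → i ≡ j
  Q-injective i j Qi≡Qj = P-injective i j (cong₂ _,_
    (affine-injective eᵃ tᵃ {{eᵃ≢0}} (cong proj₂ Qi≡Qj))
    (affine-injective eᵇ tᵇ {{eᵇ≢0}} (cong proj₁ Qi≡Qj)))

E₁ E₂ E₃ E₄ : Params × List (ℕ × ℕ)
E₁ = ⟨ 2 , 2 , 6 , 1 , 5 ⟩ , (0 , 0) ∷ (2 , 1) ∷ (4 , 1) ∷ []
E₂ = ⟨ 3 , 3 , 3 , 1 , 2 ⟩ , (0 , 0) ∷ (1 , 1) ∷ (2 , 1) ∷ []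
E₃ = ⟨ 2 , 6 , 2 , 1 , 1 ⟩ , (0 , 0) ∷ (2 , 1) ∷ (3 , 1) ∷ []
E₄ = ⟨ 2 , 2 , 4 , 1 , 3 ⟩ , (0 , 0) ∷ (3 , 2) ∷ (4 , 2) ∷ (1 , 1) ∷ []

embedding-2-2-3-2 : Embedding 2 2 3 2
embedding-2-2-3-2 = record
  { q = proj₁ E₄ ; pairs = proj₂ E₄ ; listed = there (there (there (here refl)))
  ; eᵃ = 1 ; tᵃ = 1 ; eᵇ = 1 ; tᵇ = 1 ; eᵃ≢0 = _ ; eᵇ≢0 = _
  ; a₀≡ = refl ; b₀≡ = refl ; scaleᵃ = refl ; scaleᵇ = refl
  ; covers = solutions-covered (from-yes (enumerable? 4 2 2))
  }
  where open Enumeration 2 2 3 2 1 1 1 1 (proj₂ E₄)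

embedding-6-2-1-2 : Embedding 6 2 1 2
embedding-6-2-1-2 = record
  { q = proj₁ E₃ ; pairs = proj₂ E₃ ; listed = there (there (here refl))
  ; eᵃ = 1 ; tᵃ = 0 ; eᵇ = 1 ; tᵇ = 0 ; eᵃ≢0 = _ ; eᵇ≢0 = _
  ; a₀≡ = refl ; b₀≡ = refl ; scaleᵃ = refl ; scaleᵇ = refl
  ; covers = solutions-covered (from-yes (enumerable? 4 2 2))
  }
  where open Enumeration 6 2 1 2 1 0 1 0 (proj₂ E₃)

embedding-2-2-3-4 : Embedding 2 2 3 4
embedding-2-2-3-4 = record
  { q = proj₁ E₄ ; pairs = proj₂ E₄ ; listed = there (there (there (here refl)))
  ; eᵃ = 1 ; tᵃ = 0 ; eᵇ = 1 ; tᵇ = 0 ; eᵃ≢0 = _ ; eᵇ≢0 = _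
  ; a₀≡ = refl ; b₀≡ = refl ; scaleᵃ = refl ; scaleᵇ = refl
  ; covers = solutions-covered (from-yes (enumerable? 8 3 3))
  }
  where open Enumeration 2 2 3 4 1 0 1 0 (proj₂ E₄)

embedding-4-2-3-4 : Embedding 4 2 3 4
embedding-4-2-3-4 = record
  { q = proj₁ E₄ ; pairs = proj₂ E₄ ; listed = there (there (there (here refl)))
  ; eᵃ = 2 ; tᵃ = 0 ; eᵇ = 1 ; tᵇ = 0 ; eᵃ≢0 = _ ; eᵇ≢0 = _
  ; a₀≡ = refl ; b₀≡ = refl ; scaleᵃ = refl ; scaleᵇ = refl
  ; covers = solutions-covered (from-yes (enumerable? 8 2 3))
  }
  where open Enumeration 4 2 3 4 2 0 1 0 (proj₂ E₄)

embedding-3-3-2-3 : Embedding 3 3 2 3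
embedding-3-3-2-3 = record
  { q = proj₁ E₂ ; pairs = proj₂ E₂ ; listed = there (here refl)
  ; eᵃ = 1 ; tᵃ = 0 ; eᵇ = 1 ; tᵇ = 0 ; eᵃ≢0 = _ ; eᵇ≢0 = _
  ; a₀≡ = refl ; b₀≡ = refl ; scaleᵃ = refl ; scaleᵇ = refl
  ; covers = solutions-covered (from-yes (enumerable? 9 2 2))
  }
  where open Enumeration 3 3 2 3 1 0 1 0 (proj₂ E₂)

embedding-2-2-5-6 : Embedding 2 2 5 6
embedding-2-2-5-6 = record
  { q = proj₁ E₁ ; pairs = proj₂ E₁ ; listed = here refl
  ; eᵃ = 1 ; tᵃ = 0 ; eᵇ = 1 ; tᵇ = 0 ; eᵃ≢0 = _ ; eᵇ≢0 = _
  ; a₀≡ = refl ; b₀≡ = refl ; scaleᵃ = refl ; scaleᵇ = refl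
  ; covers = solutions-covered (from-yes (enumerable? 8 3 3))
  }
  where open Enumeration 2 2 5 6 1 0 1 0 (proj₂ E₁)

embedding-2-4-5-6 : Embedding 2 4 5 6
embedding-2-4-5-6 = record
  { q = proj₁ E₁ ; pairs = proj₂ E₁ ; listed = here refl
  ; eᵃ = 1 ; tᵃ = 0 ; eᵇ = 2 ; tᵇ = 0 ; eᵃ≢0 = _ ; eᵇ≢0 = _
  ; a₀≡ = refl ; b₀≡ = refl ; scaleᵃ = refl ; scaleᵇ = refl
  ; covers = solutions-covered (from-yes (enumerable? 8 3 2))
  }
  where open Enumeration 2 4 5 6 1 0 2 0 (proj₂ E₁)

-- Repeated exponents

reduced : ∀ {p a₀ b₀ r₀ c₀} → a p ≡ a₀ → b p ≡ b₀ → r p ≡ s p * r₀ × c p ≡ s p * c₀ →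
  Embedding a₀ b₀ r₀ c₀ → Reduced p
reduced refl refl (r≡ , c≡) emb = _ , _ , r≡ , c≡ , emb

sum-normalization : ∀ {r s c} k → s * (suc k + suc k) ≡ c + c → r + s ≡ c → r ≡ s * k × c ≡ s * suc k
sum-normalization {r} {s} {c} k s[2k+2]≡2c r+s≡c =
  +-cancelʳ-≡ s r (s * k) (trans r+s≡c (trans c≡ (trans (*-suc s k) (+-comm s (s * k))))) , c≡
  where
  c≡ : c ≡ s * suc k
  c≡ = halve s (suc k) s[2k+2]≡2c

difference-normalization : ∀ {r s c} k → s * (k + k) ≡ c + c → r ≡ c + s → r ≡ s * suc k × c ≡ s * k
difference-normalization {r} {s} {c} k s[2k]≡2c r≡c+s =
  trans r≡c+s (trans (cong (_+ s) c≡) (trans (+-comm (s * k) s) (sym (*-suc s k)))) , c≡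
  where
  c≡ : c ≡ s * k
  c≡ = halve s k s[2k]≡2c

roots-of-2 : RootsBelow 2 (2 ∷ [])
roots-of-2 = from-yes (rootsBelow? 2 (2 ∷ []))

roots-of-3 : RootsBelow 3 (3 ∷ [])
roots-of-3 = from-yes (rootsBelow? 3 (3 ∷ []))

roots-of-4 : RootsBelow 4 (2 ∷ 4 ∷ [])
roots-of-4 = from-yes (rootsBelow? 4 (2 ∷ 4 ∷ []))

roots-of-6 : RootsBelow 6 (6 ∷ [])
roots-of-6 = from-yes (rootsBelow? 6 (6 ∷ []))

admissible₊⇒reduced : ∀ {p X d u B A} → ValidParams p → 1 ≤ X → 1 ≤ d → a p ^ X ≡ A → b p ^ d ≡ suc u →
  s p * (u * B) ≡ c p + c p → r p + s p ≡ c p → (u , B , A) ∈ admissible₊ → Reduced p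
admissible₊⇒reduced {p} (2≤a , 2≤b , _) 1≤X 1≤d a^X≡A b^d≡1+u 2c≡ r+s≡c (here refl)
  with root∈ roots-of-6 2≤a 1≤X a^X≡A | root∈ roots-of-2 2≤b 1≤d b^d≡1+u
... | here a≡6 | here b≡2 = reduced {p} a≡6 b≡2 (sum-normalization 1 2c≡ r+s≡c) embedding-6-2-1-2
admissible₊⇒reduced {p} (2≤a , 2≤b , _) 1≤X 1≤d a^X≡A b^d≡1+u 2c≡ r+s≡c (there (here refl))
  with root∈ roots-of-4 2≤a 1≤X a^X≡A | root∈ roots-of-2 2≤b 1≤d b^d≡1+u
... | here a≡2 | here b≡2 = reduced {p} a≡2 b≡2 (sum-normalization 3 2c≡ r+s≡c) embedding-2-2-3-4
... | there (here a≡4) | here b≡2 = reduced {p} a≡4 b≡2 (sum-normalization 3 2c≡ r+s≡c) embedding-4-2-3-4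
admissible₊⇒reduced {p} (2≤a , 2≤b , _) 1≤X 1≤d a^X≡A b^d≡1+u 2c≡ r+s≡c (there (there (here refl)))
  with root∈ roots-of-3 2≤a 1≤X a^X≡A | root∈ roots-of-3 2≤b 1≤d b^d≡1+u
... | here a≡3 | here b≡3 = reduced {p} a≡3 b≡3 (sum-normalization 2 2c≡ r+s≡c) embedding-3-3-2-3
admissible₊⇒reduced {p} (2≤a , 2≤b , _) 1≤X 1≤d a^X≡A b^d≡1+u 2c≡ r+s≡c (there (there (there (here refl))))
  with root∈ roots-of-2 2≤a 1≤X a^X≡A | root∈ roots-of-4 2≤b 1≤d b^d≡1+u
... | here a≡2 | here b≡2 = reduced {p} a≡2 b≡2 (sum-normalization 5 2c≡ r+s≡c) embedding-2-2-5-6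
... | here a≡2 | there (here b≡4) = reduced {p} a≡2 b≡4 (sum-normalization 5 2c≡ r+s≡c) embedding-2-4-5-6

power-gap : ∀ {b y₁ y₂} → 2 ≤ b → y₁ < y₂ →
  ∃[ d ] ∃[ u ] (1 ≤ d × 1 ≤ u × b ^ d ≡ suc u × b ^ y₂ ≡ suc u * b ^ y₁)
power-gap {b} {y₁} {y₂} 2≤b y₁<y₂
  with 2≤⇒suc (≤-trans 2≤b (m≤m^n (y₂ ∸ y₁) (≤-trans (s≤s z≤n) 2≤b) (m<n⇒0<n∸m y₁<y₂)))
... | u , 1≤u , 1+u≡b^d = y₂ ∸ y₁ , u , m<n⇒0<n∸m y₁<y₂ , 1≤u , sym 1+u≡b^d , (begin
  b ^ y₂                ≡⟨ cong (b ^_) (m+[n∸m]≡n (<⇒≤ y₁<y₂)) ⟨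
  b ^ (y₁ + (y₂ ∸ y₁))  ≡⟨ ^-distribˡ-+-* b y₁ (y₂ ∸ y₁) ⟩
  b ^ y₁ * b ^ (y₂ ∸ y₁) ≡⟨ *-comm (b ^ y₁) _ ⟩
  b ^ (y₂ ∸ y₁) * b ^ y₁ ≡⟨ cong (_* b ^ y₁) 1+u≡b^d ⟨
  suc u * b ^ y₁        ∎)
  where open ≡-Reasoning

collision⇒reduced : ∀ {p X y₁ y₂} → ValidParams p → 1 ≤ X → 1 ≤ y₁ → y₁ < y₂ →
  IsSolution p (0 , 0) → IsSolution p (X , y₁) → IsSolution p (X , y₂) → Reduced p
collision⇒reduced {p} {X} {y₁} {y₂} valid@(2≤a , 2≤b , 0<c , 0<r , 0<s) 1≤X 1≤y₁ y₁<y₂ sol₀ sol₁ sol₂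
  with power-gap 2≤b y₁<y₂
... | d , u , 1≤d , 1≤u , b^d≡1+u , b^y₂≡[1+u]B =
  classify (balance⇒equation {A = A} {u = u} 0<r 0<s (≤-trans 2≤B (m≤n*m B u {{>-nonZero 1≤u}}))
    rA≡c+sB s[uB]≡2c signed₀)
  where
  A B : ℕ
  A = a p ^ X
  B = b p ^ y₁
  2≤A : 2 ≤ A
  2≤A = ≤-trans 2≤a (m≤m^n X (≤-trans (s≤s z≤n) 2≤a) 1≤X)
  2≤B : 2 ≤ B
  2≤B = ≤-trans 2≤b (m≤m^n y₁ (≤-trans (s≤s z≤n) 2≤b) 1≤y₁)
  signed₀ : SignedSum (r p) (s p) (c p)
  signed₀ = subst₂ (λ R S → SignedSum R S (c p)) (*-identityʳ (r p)) (*-identityʳ (s p))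
    (isSolution⇒signedSum {p} 0 0 0<c sol₀)
  balance : r p * A ≡ c p + s p * B × s p * (u * B) ≡ c p + c p
  balance = sharedFirstTerm⇒balance 0<r 0<s 2≤A 2≤B 1≤u signed₀ (isSolution⇒signedSum X y₁ 0<c sol₁)
    (subst (λ S → SignedSum (r p * A) (s p * S) (c p)) b^y₂≡[1+u]B (isSolution⇒signedSum X y₂ 0<c sol₂))
  rA≡c+sB : r p * A ≡ c p + s p * B
  rA≡c+sB = proj₁ balance
  s[uB]≡2c : s p * (u * B) ≡ c p + c p
  s[uB]≡2c = proj₂ balance
  classify : r p + s p ≡ c p × Equation₊ u B A ⊎ r p ≡ c p + s p × Equation₋ u B A → Reduced p
  classify (inj₁ (r+s≡c , eq₊)) =
    admissible₊⇒reduced valid 1≤X 1≤d refl b^d≡1+u s[uB]≡2c r+s≡c (equation₊-admissible 1≤u 2≤B 2≤A eq₊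
      (common-factor⇒¬coprime 2≤b (m∣m^n (b p) 1≤y₁) (subst (b p ∣_) b^d≡1+u (m∣m^n (b p) 1≤d))))
  classify (inj₂ (r≡c+s , eq₋)) with equation₋-solution 1≤u 2≤B 2≤A eq₋
  ... | u≡1 , B≡4 , A≡2
    with root∈ roots-of-2 2≤a 1≤X A≡2 | root∈ roots-of-2 2≤b 1≤d (trans b^d≡1+u (cong suc u≡1))
  ...   | here a≡2 | here b≡2 = reduced {p} a≡2 b≡2
    (difference-normalization 2 (subst (λ z → s p * z ≡ c p + c p) (cong₂ _*_ u≡1 B≡4) s[uB]≡2c) r≡c+s)
    embedding-2-2-3-2

injective⊎collision : ∀ {m} (f : Fin m → ℕ) →
  (∀ i j → f i ≡ f j → i ≡ j) ⊎ ∃[ i ] ∃[ j ] (i ≢ j × f i ≡ f j)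
injective⊎collision f with any? (λ i → any? (λ j → ¬? (i Fin.≟ j) ×-dec f i ≟ f j))
... | yes (i , j , i≢j , fi≡fj) = inj₂ (i , j , i≢j , fi≡fj)
... | no ¬collision =
  inj₁ λ i j fi≡fj → decidable-stable (i Fin.≟ j) (λ i≢j → ¬collision (i , j , i≢j , fi≡fj))

x-collision⇒reduced : ∀ {p n P} → SetOfSolutions p (suc n) P → P zero ≡ (0 , 0) →
  (∀ (i : Fin n) → 0 < proj₁ (P (suc i)) × 0 < proj₂ (P (suc i))) →
  ∀ i j → i ≢ j → proj₁ (P i) ≡ proj₁ (P j) → Reduced p
x-collision⇒reduced sos P0 positive zero zero i≢j _ = ⊥-elim (i≢j refl)
x-collision⇒reduced sos P0 positive zero (suc j) _ x≡x′ =
  ⊥-elim (<⇒≢ (proj₁ (positive j)) (trans (sym (cong proj₁ P0)) x≡x′))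
x-collision⇒reduced sos P0 positive (suc i) zero _ x≡x′ =
  ⊥-elim (<⇒≢ (proj₁ (positive i)) (trans (sym (cong proj₁ P0)) (sym x≡x′)))
x-collision⇒reduced {p} {n} {P} (valid , _ , P-injective , P-solutions) P0 positive
  (suc i) (suc j) i≢j x≡x′ =
  by-order (<-cmp y y′)
  where
  y y′ : ℕ
  y = proj₂ (P (suc i))
  y′ = proj₂ (P (suc j))
  origin : IsSolution p (0 , 0)
  origin = subst (IsSolution p) P0 (P-solutions zero)
  by-order : Tri (y < y′) (y ≡ y′) (y′ < y) → Reduced p
  by-order (tri< y<y′ _ _) = collision⇒reduced valid (proj₁ (positive i)) (proj₂ (positive i)) y<y′ origin
    (P-solutions (suc i)) (subst (λ x → IsSolution p (x , y′)) (sym x≡x′) (P-solutions (suc j)))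
  by-order (tri≈ _ y≡y′ _) = ⊥-elim (i≢j (P-injective (suc i) (suc j) (cong₂ _,_ x≡x′ y≡y′)))
  by-order (tri> _ _ y′<y) = collision⇒reduced valid (proj₁ (positive j)) (proj₂ (positive j)) y′<y origin
    (P-solutions (suc j)) (subst (λ x → IsSolution p (x , y)) x≡x′ (P-solutions (suc i)))

-- Associates

isSolution-assoc : ∀ p x y → IsSolution p (x , y) → IsSolution (assocParams p) (y , x)
isSolution-assoc p x y (u , v , u≤1 , v≤1 , eq) =
  v , u , v≤1 , u≤1
  , trans (ℤ.+-comm (sign v ℤ.* ℤ.+ s p ℤ.* (ℤ.+ b p) ℤ.^ y) (sign u ℤ.* ℤ.+ r p ℤ.* (ℤ.+ a p) ℤ.^ x)) eq

setOfSolutions-assoc : ∀ {p N P} → SetOfSolutions p N P → SetOfSolutions (assocParams p) N (swapPair ∘ P)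
setOfSolutions-assoc {p} {P = P} ((1<a , 1<b , 0<c , 0<r , 0<s) , 2<N , P-injective , P-solutions) =
  (1<b , 1<a , 0<c , 0<s , 0<r) , 2<N , (λ i j e → P-injective i j (cong swapPair e))
  , λ i → isSolution-assoc p (proj₁ (P i)) (proj₂ (P i)) (P-solutions i)

sameFamily-assoc : ∀ {p N P q Q} → SameFamily (assocParams p) N (swapPair ∘ P) q Q →
  SameFamily p N P (assocParams q) (swapPair ∘ Q)
sameFamily-assoc (powers-a , powers-b , k , k>0 , kc≡ , matched) =
  powers-b , powers-a , k , k>0 , kc≡
  , λ i → proj₁ (matched i) , proj₂ (proj₂ (matched i)) , proj₁ (proj₂ (matched i))

exceptionalCase-assoc : ∀ {p n P} →
  ExceptionalCase (assocParams p) (suc n) (swapPair ∘ P) → ExceptionalCase p (suc n) P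
exceptionalCase-assoc {p} {n} {P} (E , E∈ , Q , subset , inj₁ family) =
  E , E∈ , Q , subset , inj₂ (sameFamily-assoc {p} {suc n} {P} {proj₁ E} {Q} family)
exceptionalCase-assoc {p} {n} {P} (E , E∈ , Q , subset , inj₂ family) =
  E , E∈ , Q , subset , inj₁ (sameFamily-assoc {p} {suc n} {P} {assocParams (proj₁ E)} {swapPair ∘ Q} family)

lemma4 : (p : Params) (n : ℕ) (P : Fin (suc n) → ℕ × ℕ)
         → SetOfSolutions p (suc n) P
         → P zero ≡ (0 , 0)
         → (∀ (i : Fin n) → 0 < proj₁ (P (suc i)) × 0 < proj₂ (P (suc i)))
         → ((∀ i j → proj₁ (P i) ≡ proj₁ (P j) → i ≡ j)
            × (∀ i j → proj₂ (P i) ≡ proj₂ (P j) → i ≡ j))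
           ⊎ ExceptionalCase p (suc n) P
lemma4 p n P sos P0 positive with injective⊎collision (proj₁ ∘ P) | injective⊎collision (proj₂ ∘ P)
... | inj₁ x-injective | inj₁ y-injective = inj₁ (x-injective , y-injective)
... | inj₂ (i , j , i≢j , x≡x′) | _ =
  inj₂ (reduced⇒exceptionalCase sos (x-collision⇒reduced sos P0 positive i j i≢j x≡x′))
... | inj₁ _ | inj₂ (i , j , i≢j , y≡y′) = inj₂ (exceptionalCase-assoc {p} {n} {P}
  (reduced⇒exceptionalCase sos′
    (x-collision⇒reduced sos′ (cong swapPair P0) (swap ∘ positive) i j i≢j y≡y′)))
  where
  sos′ : SetOfSolutions (assocParams p) (suc n) (swapPair ∘ P)
  sos′ = setOfSolutions-assoc sos
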